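{- Let $G$ be a graph with vertex set $[n]$ and edge set $E(G)$, $e(G)=|E(G)|$. Then the polynomial $$P_G=\sum_{a\in\{0,1\}^n}\Big(\sum_{\{u,v\}\in E(G)}a_ua_v-1\Big)^2\prod_{i=1}^n x_{i,a_i}$$ in the $2n$ variables $x_{1,0},x_{1,1},\dots,x_{n,0},x_{n,1}$ has a $\Sigma\Pi\Sigma$ formula of size $O(e(G)^2n)$.
   Context: A $\Sigma\Pi\Sigma$ formula over $\mathbb{R}$ computes a polynomial of the form $\sum_i\prod_j\ell_{i,j}$ with each $\ell_{i,j}$ an affine linear form; its size is the number of nodes/wires. -}

module Defs where

open import Data.Nat as ℕ using (ℕ; zero; suc; _<ᵇ_)
open import Data.Bool using (Bool; true; false; _∧_; if_then_else_)
open import Data.Fin using (Fin; toℕ)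
open import Data.Vec using (Vec; []; _∷_; lookup)
open import Data.List using (List; []; _∷_; map; concatMap; filterᵇ; allFin; length; _++_)
open import Data.Product using (_×_; _,_)
open import Data.Rational using (ℚ; 0ℚ; 1ℚ; _+_; _*_; _-_)
open import Relation.Binary.PropositionalEquality using (_≡_)

record Graph (n : ℕ) : Set where
  field
    adj    : Fin n → Fin n → Bool
    sym    : ∀ u v → adj u v ≡ adj v u
    irrefl : ∀ u → adj u u ≡ false
open Graph public

edges : ∀ {n} → Graph n → List (Fin n × Fin n)
edges {n} G =
  concatMap (λ u → map (λ v → (u , v))
                       (filterᵇ (λ v → (toℕ u <ᵇ toℕ v) ∧ adj G u v) (allFin n)))
            (allFin n)

e : ∀ {n} → Graph n → ℕ
e G = length (edges G)

Σℚ : List ℚ → ℚ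
Σℚ []       = 0ℚ
Σℚ (q ∷ qs) = q + Σℚ qs

Πℚ : List ℚ → ℚ
Πℚ []       = 1ℚ
Πℚ (q ∷ qs) = q * Πℚ qs

cube : (n : ℕ) → List (Vec Bool n)
cube zero    = [] ∷ []
cube (suc n) = map (false ∷_) (cube n) ++ map (true ∷_) (cube n)

bit : Bool → ℚ
bit false = 0ℚ
bit true  = 1ℚ

Var : ℕ → Set
Var n = Fin n × Bool

P : ∀ {n} → Graph n → (Var n → ℚ) → ℚ
P {n} G x = Σℚ (map term (cube n))
  where
  term : Vec Bool n → ℚ
  term a =
    let s = Σℚ (map (λ { (u , v) → bit (lookup a u) * bit (lookup a v) }) (edges G)) - 1ℚ
    in (s * s) * Πℚ (map (λ i → x (i , lookup a i)) (allFin n))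

record Affine (V : Set) : Set where
  constructor affine
  field
    const : ℚ
    terms : List (V × ℚ)
open Affine public

SPS : Set → Set
SPS V = List (List (Affine V))

evalAff : ∀ {V} → (V → ℚ) → Affine V → ℚ
evalAff x ℓ = const ℓ + Σℚ (map (λ { (v , c) → c * x v }) (terms ℓ))

evalSPS : ∀ {V} → (V → ℚ) → SPS V → ℚ
evalSPS x F = Σℚ (map (λ ls → Πℚ (map (evalAff x) ls)) F)

-- Size = number of nodes/wires: an affine-form node with k variable inputs
-- contributes 1 + k (node + input wires), plus 1 for its wire to the product gate;
-- each product gate contributes 1 (node) + 1 (wire to top gate); plus 1 for the top Σ gate.
sizeAff : ∀ {V} → Affine V → ℕ
sizeAff ℓ = suc (length (terms ℓ))

sumℕ : List ℕ → ℕ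
sumℕ []       = 0
sumℕ (k ∷ ks) = k ℕ.+ sumℕ ks

sizeSPS : ∀ {V} → SPS V → ℕ
sizeSPS F = suc (sumℕ (map (λ ls → 2 ℕ.+ sumℕ (map (λ ℓ → suc (sizeAff ℓ)) ls)) F))

-- s(a) = Σ_{uv ∈ E} a_u a_v − 1 is a linear combination of e(G) + 1 functions of product
-- form a ↦ Π_i c_i(a_i) on the cube, hence s² is a combination of (e(G) + 1)² of them.
-- For one product-form function, Σ_a Π_i c_i(a_i) x_{i,a_i} = Π_i (c_i(0) x_{i,0} + c_i(1) x_{i,1}),
-- a single product of n affine forms; so P_G is a sum of (e(G) + 1)² products of n + 1 affine
-- forms, each of constant size.
module Submission where

open import Algebra.Bundles using (CommutativeMonoid)
open import Data.Bool using (Bool; true; false)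
open import Data.Fin using (Fin; zero; suc)
open import Data.List using (List; []; _∷_; _++_; map; concatMap; tabulate; allFin; length)
import Data.List.Properties as List
open import Data.Nat using (ℕ; zero; suc; _≤_; _*_; _+_; _^_; s≤s; z≤n)
import Data.Nat.Properties as ℕₚ
open import Data.Nat.Solver using (module +-*-Solver)
open import Data.Product using (Σ; _×_; _,_; curry)
open import Data.Rational as ℚ using (ℚ; 0ℚ; 1ℚ)
import Data.Rational.Properties as ℚₚ
open import Data.Vec using (Vec; []; _∷_; lookup)
open import Function using (id; _∘_)
open import Relation.Binary.PropositionalEquality
  using (_≡_; refl; sym; trans; cong; cong₂; module ≡-Reasoning)

open import Defs hiding (sym)

open import Algebra.Properties.CommutativeSemigroup
  (CommutativeMonoid.commutativeSemigroup ℚₚ.+-0-commutativeMonoid)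
  using () renaming (interchange to +-interchange)
open import Algebra.Properties.CommutativeSemigroup
  (CommutativeMonoid.commutativeSemigroup ℚₚ.*-1-commutativeMonoid)
  using () renaming (interchange to *-interchange)

Σℚ-++ : (xs ys : List ℚ) → Σℚ (xs ++ ys) ≡ Σℚ xs ℚ.+ Σℚ ys
Σℚ-++ []       ys = sym (ℚₚ.+-identityˡ _)
Σℚ-++ (x ∷ xs) ys = trans (cong (x ℚ.+_) (Σℚ-++ xs ys)) (sym (ℚₚ.+-assoc x _ _))

module _ {A : Set} where

  Σℚ-cong : {f g : A → ℚ} → (∀ a → f a ≡ g a) → ∀ xs →
    Σℚ (map f xs) ≡ Σℚ (map g xs)
  Σℚ-cong f≗g xs = cong Σℚ (List.map-cong f≗g xs)

  Σℚ-*ˡ : ∀ k (f : A → ℚ) xs →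
    k ℚ.* Σℚ (map f xs) ≡ Σℚ (map (λ a → k ℚ.* f a) xs)
  Σℚ-*ˡ k f []       = ℚₚ.*-zeroʳ k
  Σℚ-*ˡ k f (x ∷ xs) =
    trans (ℚₚ.*-distribˡ-+ k (f x) _) (cong (k ℚ.* f x ℚ.+_) (Σℚ-*ˡ k f xs))

  Σℚ-*ʳ : ∀ k (f : A → ℚ) xs →
    Σℚ (map f xs) ℚ.* k ≡ Σℚ (map (λ a → f a ℚ.* k) xs)
  Σℚ-*ʳ k f []       = ℚₚ.*-zeroˡ k
  Σℚ-*ʳ k f (x ∷ xs) =
    trans (ℚₚ.*-distribʳ-+ k (f x) _) (cong (f x ℚ.* k ℚ.+_) (Σℚ-*ʳ k f xs))

  Σℚ-0 : ∀ xs → Σℚ (map (λ (_ : A) → 0ℚ) xs) ≡ 0ℚ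
  Σℚ-0 []       = refl
  Σℚ-0 (_ ∷ xs) = trans (ℚₚ.+-identityˡ _) (Σℚ-0 xs)

  Σℚ-+ : ∀ (f g : A → ℚ) xs →
    Σℚ (map (λ a → f a ℚ.+ g a) xs) ≡ Σℚ (map f xs) ℚ.+ Σℚ (map g xs)
  Σℚ-+ f g []       = sym (ℚₚ.+-identityˡ 0ℚ)
  Σℚ-+ f g (x ∷ xs) =
    trans (cong (f x ℚ.+ g x ℚ.+_) (Σℚ-+ f g xs)) (+-interchange (f x) (g x) _ _)

module _ {A B : Set} where

  Σℚ-swap : ∀ (f : A → B → ℚ) xs ys →
    Σℚ (map (λ a → Σℚ (map (f a) ys)) xs)
      ≡ Σℚ (map (λ b → Σℚ (map (λ a → f a b) xs)) ys)
  Σℚ-swap f []       ys = sym (Σℚ-0 ys)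
  Σℚ-swap f (x ∷ xs) ys =
    trans (cong (Σℚ (map (f x) ys) ℚ.+_) (Σℚ-swap f xs ys))
          (sym (Σℚ-+ (f x) (λ b → Σℚ (map (λ a → f a b) xs)) ys))

  Σℚ-concatMap : ∀ (f : B → ℚ) (g : A → List B) xs →
    Σℚ (map f (concatMap g xs)) ≡ Σℚ (map (λ a → Σℚ (map f (g a))) xs)
  Σℚ-concatMap f g []       = refl
  Σℚ-concatMap f g (x ∷ xs) = begin
    Σℚ (map f (g x ++ concatMap g xs))
      ≡⟨ cong Σℚ (List.map-++ f (g x) _) ⟩
    Σℚ (map f (g x) ++ map f (concatMap g xs))
      ≡⟨ Σℚ-++ (map f (g x)) _ ⟩
    Σℚ (map f (g x)) ℚ.+ Σℚ (map f (concatMap g xs))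
      ≡⟨ cong (Σℚ (map f (g x)) ℚ.+_) (Σℚ-concatMap f g xs) ⟩
    Σℚ (map f (g x)) ℚ.+ Σℚ (map (λ a → Σℚ (map f (g a))) xs) ∎
    where open ≡-Reasoning

Πℚ-tabulate-* : ∀ {n} (f g : Fin n → ℚ) →
  Πℚ (tabulate (λ i → f i ℚ.* g i)) ≡ Πℚ (tabulate f) ℚ.* Πℚ (tabulate g)
Πℚ-tabulate-* {zero}  f g = sym (ℚₚ.*-identityˡ 1ℚ)
Πℚ-tabulate-* {suc n} f g =
  trans (cong (f zero ℚ.* g zero ℚ.*_) (Πℚ-tabulate-* (f ∘ suc) (g ∘ suc)))
        (*-interchange (f zero) (g zero) _ _)

sumℕ-map-const : ∀ {A : Set} (f : A → ℕ) {k} → (∀ a → f a ≡ k) → ∀ xs →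
  sumℕ (map f xs) ≡ length xs * k
sumℕ-map-const f f≡k []       = refl
sumℕ-map-const f f≡k (x ∷ xs) = cong₂ _+_ (f≡k x) (sumℕ-map-const f f≡k xs)

Weight : ℕ → Set
Weight n = Fin n → Bool → ℚ

evalWeight : ∀ {n} → Weight n → Vec Bool n → ℚ
evalWeight c a = Πℚ (tabulate (λ i → c i (lookup a i)))

_⊙_ : ∀ {n} → Weight n → Weight n → Weight n
(c ⊙ d) i b = c i b ℚ.* d i b

evalWeight-⊙ : ∀ {n} (c d : Weight n) a →
  evalWeight (c ⊙ d) a ≡ evalWeight c a ℚ.* evalWeight d a
evalWeight-⊙ c d a = Πℚ-tabulate-* (λ i → c i (lookup a i)) (λ i → d i (lookup a i))

𝟙 : ∀ {n} → Weight n
𝟙 _ _ = 1ℚ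

evalWeight-𝟙 : ∀ {n} (a : Vec Bool n) → evalWeight 𝟙 a ≡ 1ℚ
evalWeight-𝟙 []      = refl
evalWeight-𝟙 (_ ∷ a) = trans (ℚₚ.*-identityˡ _) (evalWeight-𝟙 a)

Σℚ-cube-evalWeight : ∀ {n} (c : Weight n) →
  Σℚ (map (evalWeight c) (cube n)) ≡ Πℚ (tabulate (λ i → c i false ℚ.+ c i true))
Σℚ-cube-evalWeight {zero}  c = ℚₚ.+-identityʳ 1ℚ
Σℚ-cube-evalWeight {suc n} c = begin
  Σℚ (map (evalWeight c) (half false ++ half true))
    ≡⟨ cong Σℚ (List.map-++ (evalWeight c) (half false) (half true)) ⟩
  Σℚ (map (evalWeight c) (half false) ++ map (evalWeight c) (half true))
    ≡⟨ Σℚ-++ (map (evalWeight c) (half false)) (map (evalWeight c) (half true)) ⟩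
  Σℚ (map (evalWeight c) (half false)) ℚ.+ Σℚ (map (evalWeight c) (half true))
    ≡⟨ cong₂ ℚ._+_ (Σℚ-half false) (Σℚ-half true) ⟩
  c zero false ℚ.* rest ℚ.+ c zero true ℚ.* rest
    ≡⟨ sym (ℚₚ.*-distribʳ-+ rest (c zero false) (c zero true)) ⟩
  (c zero false ℚ.+ c zero true) ℚ.* rest ∎
  where
  open ≡-Reasoning
  half : Bool → List (Vec Bool (suc n))
  half b = map (b ∷_) (cube n)
  rest : ℚ
  rest = Πℚ (tabulate (λ i → c (suc i) false ℚ.+ c (suc i) true))
  Σℚ-half : ∀ b → Σℚ (map (evalWeight c) (half b)) ≡ c zero b ℚ.* rest
  Σℚ-half b = begin
    Σℚ (map (evalWeight c) (half b))
      ≡⟨ cong Σℚ (sym (List.map-∘ (cube n))) ⟩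
    Σℚ (map (λ a → c zero b ℚ.* evalWeight (c ∘ suc) a) (cube n))
      ≡⟨ sym (Σℚ-*ˡ (c zero b) (evalWeight (c ∘ suc)) (cube n)) ⟩
    c zero b ℚ.* Σℚ (map (evalWeight (c ∘ suc)) (cube n))
      ≡⟨ cong (c zero b ℚ.*_) (Σℚ-cube-evalWeight (c ∘ suc)) ⟩
    c zero b ℚ.* rest ∎

Combination : ℕ → Set
Combination n = List (ℚ × Weight n)

evalTerm : ∀ {n} → ℚ × Weight n → Vec Bool n → ℚ
evalTerm (k , c) a = k ℚ.* evalWeight c a

evalComb : ∀ {n} → Combination n → Vec Bool n → ℚ
evalComb ts a = Σℚ (map (λ t → evalTerm t a) ts)

_⊗ₜ_ : ∀ {n} → ℚ × Weight n → ℚ × Weight n → ℚ × Weight n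
(k , c) ⊗ₜ (l , d) = k ℚ.* l , c ⊙ d

_⊗_ : ∀ {n} → Combination n → Combination n → Combination n
ts ⊗ us = concatMap (λ t → map (t ⊗ₜ_) us) ts

evalTerm-⊗ₜ : ∀ {n} (s t : ℚ × Weight n) a →
  evalTerm (s ⊗ₜ t) a ≡ evalTerm s a ℚ.* evalTerm t a
evalTerm-⊗ₜ (k , c) (l , d) a =
  trans (cong (k ℚ.* l ℚ.*_) (evalWeight-⊙ c d a)) (*-interchange k l _ _)

evalComb-⊗ : ∀ {n} (ts us : Combination n) a →
  evalComb (ts ⊗ us) a ≡ evalComb ts a ℚ.* evalComb us a
evalComb-⊗ ts us a = begin
  Σℚ (map (λ t → evalTerm t a) (ts ⊗ us))
    ≡⟨ Σℚ-concatMap (λ t → evalTerm t a) (λ s → map (s ⊗ₜ_) us) ts ⟩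
  Σℚ (map (λ s → Σℚ (map (λ t → evalTerm t a) (map (s ⊗ₜ_) us))) ts)
    ≡⟨ Σℚ-cong (λ s → trans (cong Σℚ (sym (List.map-∘ us)))
                            (Σℚ-cong (λ t → evalTerm-⊗ₜ s t a) us)) ts ⟩
  Σℚ (map (λ s → Σℚ (map (λ t → evalTerm s a ℚ.* evalTerm t a) us)) ts)
    ≡⟨ Σℚ-cong (λ s → sym (Σℚ-*ˡ (evalTerm s a) (λ t → evalTerm t a) us)) ts ⟩
  Σℚ (map (λ s → evalTerm s a ℚ.* evalComb us a) ts)
    ≡⟨ sym (Σℚ-*ʳ (evalComb us a) (λ s → evalTerm s a) ts) ⟩
  evalComb ts a ℚ.* evalComb us a ∎
  where open ≡-Reasoning

length-⊗ : ∀ {n} (ts us : Combination n) → length (ts ⊗ us) ≡ length ts * length us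
length-⊗ []       us = refl
length-⊗ (t ∷ ts) us =
  trans (List.length-++ (map (t ⊗ₜ_) us))
        (cong₂ _+_ (List.length-map (t ⊗ₜ_) us) (length-⊗ ts us))

monomial : ∀ {n} → (Var n → ℚ) → Vec Bool n → ℚ
monomial x = evalWeight (curry x)

linearForm : ∀ {n} → Weight n → Fin n → Affine (Var n)
linearForm c i = affine 0ℚ (((i , false) , c i false) ∷ ((i , true) , c i true) ∷ [])

productGate : ∀ {n} → ℚ × Weight n → List (Affine (Var n))
productGate {n} (k , c) = affine k [] ∷ map (linearForm c) (allFin n)

cubeFormula : ∀ {n} → Combination n → SPS (Var n)
cubeFormula = map productGate

module _ {n : ℕ} (x : Var n → ℚ) where

  evalAff-linearForm : ∀ (c : Weight n) i →
    evalAff x (linearForm c i) ≡ (c ⊙ curry x) i false ℚ.+ (c ⊙ curry x) i true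
  evalAff-linearForm c i =
    trans (ℚₚ.+-identityˡ _) (cong ((c ⊙ curry x) i false ℚ.+_) (ℚₚ.+-identityʳ _))

  Πℚ-productGate : ∀ t →
    Πℚ (map (evalAff x) (productGate t))
      ≡ Σℚ (map (λ a → evalTerm t a ℚ.* monomial x a) (cube n))
  Πℚ-productGate (k , c) = begin
    (k ℚ.+ 0ℚ) ℚ.* Πℚ (map (evalAff x) (map (linearForm c) (allFin n)))
      ≡⟨ cong₂ ℚ._*_ (ℚₚ.+-identityʳ k) (cong Πℚ linearForms) ⟩
    k ℚ.* Πℚ (tabulate (λ i → (c ⊙ curry x) i false ℚ.+ (c ⊙ curry x) i true))
      ≡⟨ cong (k ℚ.*_) (sym (Σℚ-cube-evalWeight (c ⊙ curry x))) ⟩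
    k ℚ.* Σℚ (map (evalWeight (c ⊙ curry x)) (cube n))
      ≡⟨ Σℚ-*ˡ k (evalWeight (c ⊙ curry x)) (cube n) ⟩
    Σℚ (map (λ a → k ℚ.* evalWeight (c ⊙ curry x) a) (cube n))
      ≡⟨ Σℚ-cong (λ a → trans (cong (k ℚ.*_) (evalWeight-⊙ c (curry x) a))
                              (sym (ℚₚ.*-assoc k _ _))) (cube n) ⟩
    Σℚ (map (λ a → evalTerm (k , c) a ℚ.* monomial x a) (cube n)) ∎
    where
    open ≡-Reasoning
    linearForms : map (evalAff x) (map (linearForm c) (allFin n))
                ≡ tabulate (λ i → (c ⊙ curry x) i false ℚ.+ (c ⊙ curry x) i true)
    linearForms = begin
      map (evalAff x) (map (linearForm c) (allFin n))
        ≡⟨ sym (List.map-∘ (allFin n)) ⟩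
      map (evalAff x ∘ linearForm c) (tabulate id)
        ≡⟨ List.map-tabulate id (evalAff x ∘ linearForm c) ⟩
      tabulate (evalAff x ∘ linearForm c)
        ≡⟨ List.tabulate-cong (evalAff-linearForm c) ⟩
      tabulate (λ i → (c ⊙ curry x) i false ℚ.+ (c ⊙ curry x) i true) ∎

  evalSPS-cubeFormula : ∀ ts →
    evalSPS x (cubeFormula ts) ≡ Σℚ (map (λ a → evalComb ts a ℚ.* monomial x a) (cube n))
  evalSPS-cubeFormula ts = begin
    Σℚ (map (λ ls → Πℚ (map (evalAff x) ls)) (map productGate ts))
      ≡⟨ cong Σℚ (sym (List.map-∘ ts)) ⟩
    Σℚ (map (λ t → Πℚ (map (evalAff x) (productGate t))) ts)
      ≡⟨ Σℚ-cong Πℚ-productGate ts ⟩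
    Σℚ (map (λ t → Σℚ (map (λ a → evalTerm t a ℚ.* monomial x a) (cube n))) ts)
      ≡⟨ Σℚ-swap (λ t a → evalTerm t a ℚ.* monomial x a) ts (cube n) ⟩
    Σℚ (map (λ a → Σℚ (map (λ t → evalTerm t a ℚ.* monomial x a) ts)) (cube n))
      ≡⟨ Σℚ-cong (λ a → sym (Σℚ-*ʳ (monomial x a) (λ t → evalTerm t a) ts))
                 (cube n) ⟩
    Σℚ (map (λ a → evalComb ts a ℚ.* monomial x a) (cube n)) ∎
    where open ≡-Reasoning

-- A product gate and its constant form cost 2 each, every linear form costs 4.
sizeSPS-cubeFormula : ∀ {n} (ts : Combination n) →
  sizeSPS (cubeFormula ts) ≡ suc (length ts * (suc n * 4))
sizeSPS-cubeFormula {n} ts =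
  cong suc (trans (cong sumℕ (sym (List.map-∘ ts))) (sumℕ-map-const _ gateSize ts))
  where
  gateSize : ∀ t → 2 + sumℕ (map (λ ℓ → suc (sizeAff ℓ)) (productGate t)) ≡ suc n * 4
  gateSize (_ , c) = cong (4 +_) (begin
    sumℕ (map (λ ℓ → suc (sizeAff ℓ)) (map (linearForm c) (allFin n)))
      ≡⟨ cong sumℕ (sym (List.map-∘ (allFin n))) ⟩
    sumℕ (map (λ i → suc (sizeAff (linearForm c i))) (allFin n))
      ≡⟨ sumℕ-map-const _ (λ _ → refl) (allFin n) ⟩
    length (allFin n) * 4
      ≡⟨ cong (_* 4) (List.length-tabulate {n = n} id) ⟩
    n * 4 ∎)
    where open ≡-Reasoning

bitAt : ∀ {n} → Fin n → Weight n
bitAt zero    zero    b = bit b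
bitAt zero    (suc _) _ = 1ℚ
bitAt (suc _) zero    _ = 1ℚ
bitAt (suc u) (suc i) b = bitAt u i b

evalWeight-bitAt : ∀ {n} (u : Fin n) a → evalWeight (bitAt u) a ≡ bit (lookup a u)
evalWeight-bitAt zero    (b ∷ a) =
  trans (cong (bit b ℚ.*_) (evalWeight-𝟙 a)) (ℚₚ.*-identityʳ (bit b))
evalWeight-bitAt (suc u) (_ ∷ a) = trans (ℚₚ.*-identityˡ _) (evalWeight-bitAt u a)

bothIn : ∀ {n} → Vec Bool n → Fin n × Fin n → ℚ
bothIn a (u , v) = bit (lookup a u) ℚ.* bit (lookup a v)

inducedEdges : ∀ {n} → Graph n → Vec Bool n → ℚ
inducedEdges G a = Σℚ (map (bothIn a) (edges G))

edgeTerm : ∀ {n} → Fin n × Fin n → ℚ × Weight n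
edgeTerm (u , v) = 1ℚ , bitAt u ⊙ bitAt v

inducedEdgesMinusOne : ∀ {n} → Graph n → Combination n
inducedEdgesMinusOne G = (ℚ.- 1ℚ , 𝟙) ∷ map edgeTerm (edges G)

evalComb-inducedEdgesMinusOne : ∀ {n} (G : Graph n) a →
  evalComb (inducedEdgesMinusOne G) a ≡ inducedEdges G a ℚ.- 1ℚ
evalComb-inducedEdgesMinusOne G a = begin
  ℚ.- 1ℚ ℚ.* evalWeight 𝟙 a ℚ.+ Σℚ (map (λ t → evalTerm t a) (map edgeTerm (edges G)))
    ≡⟨ cong₂ ℚ._+_ constantTerm edgeSum ⟩
  ℚ.- 1ℚ ℚ.+ inducedEdges G a
    ≡⟨ ℚₚ.+-comm (ℚ.- 1ℚ) (inducedEdges G a) ⟩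
  inducedEdges G a ℚ.- 1ℚ ∎
  where
  open ≡-Reasoning
  evalTerm-edgeTerm : ∀ uv → evalTerm (edgeTerm uv) a ≡ bothIn a uv
  evalTerm-edgeTerm (u , v) =
    trans (ℚₚ.*-identityˡ _)
          (trans (evalWeight-⊙ (bitAt u) (bitAt v) a)
                 (cong₂ ℚ._*_ (evalWeight-bitAt u a) (evalWeight-bitAt v a)))
  edgeSum : Σℚ (map (λ t → evalTerm t a) (map edgeTerm (edges G))) ≡ inducedEdges G a
  edgeSum =
    trans (cong Σℚ (sym (List.map-∘ (edges G)))) (Σℚ-cong evalTerm-edgeTerm (edges G))
  constantTerm : ℚ.- 1ℚ ℚ.* evalWeight 𝟙 a ≡ ℚ.- 1ℚ
  constantTerm = trans (cong (ℚ.- 1ℚ ℚ.*_) (evalWeight-𝟙 a)) (ℚₚ.*-identityʳ (ℚ.- 1ℚ))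

formulaP : ∀ {n} → Graph n → SPS (Var n)
formulaP G = cubeFormula (inducedEdgesMinusOne G ⊗ inducedEdgesMinusOne G)

evalSPS-formulaP : ∀ {n} (G : Graph n) x → evalSPS x (formulaP G) ≡ P G x
evalSPS-formulaP {n} G x =
  trans (evalSPS-cubeFormula x (s ⊗ s))
        (Σℚ-cong (λ a → cong₂ ℚ._*_ (evalComb-s² a) (monomial≡ a)) (cube n))
  where
  s : Combination n
  s = inducedEdgesMinusOne G
  evalComb-s² : ∀ a →
    evalComb (s ⊗ s) a ≡ (inducedEdges G a ℚ.- 1ℚ) ℚ.* (inducedEdges G a ℚ.- 1ℚ)
  evalComb-s² a = trans (evalComb-⊗ s s a)
    (cong₂ ℚ._*_ (evalComb-inducedEdgesMinusOne G a) (evalComb-inducedEdgesMinusOne G a))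
  monomial≡ : ∀ a → monomial x a ≡ Πℚ (map (λ i → x (i , lookup a i)) (allFin n))
  monomial≡ a = cong Πℚ (sym (List.map-tabulate id (λ i → x (i , lookup a i))))

sizeSPS-formulaP : ∀ {n} (G : Graph n) →
  sizeSPS (formulaP G) ≡ suc (suc (e G) * suc (e G) * (suc n * 4))
sizeSPS-formulaP {n} G =
  trans (sizeSPS-cubeFormula (s ⊗ s))
        (cong (λ m → suc (m * (suc n * 4)))
              (trans (length-⊗ s s) (cong₂ _*_ length-s length-s)))
  where
  s : Combination n
  s = inducedEdgesMinusOne G
  length-s : length s ≡ suc (e G)
  length-s = cong suc (List.length-map edgeTerm (edges G))

1+[1+m]²[4+4k]≤5[m+1]²[k+1] : ∀ m k →
  suc (suc m * suc m * (suc k * 4)) ≤ 5 * ((m + 1) ^ 2 * (k + 1))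
1+[1+m]²[4+4k]≤5[m+1]²[k+1] m k = begin
  suc (suc m * suc m * (suc k * 4)) ≡⟨ cong suc (size≡ m k) ⟩
  suc (4 * N)                       ≤⟨ ℕₚ.+-monoˡ-≤ (4 * N) (s≤s z≤n) ⟩
  5 * N                             ≡⟨ cong (5 *_) (sym (N≡ m k)) ⟩
  5 * ((m + 1) ^ 2 * (k + 1))       ∎
  where
  open ℕₚ.≤-Reasoning
  open +-*-Solver
  N : ℕ
  N = suc m * suc m * suc k
  size≡ : ∀ m k → suc m * suc m * (suc k * 4) ≡ 4 * (suc m * suc m * suc k)
  size≡ = solve 2 (λ m k → (con 1 :+ m) :* (con 1 :+ m) :* ((con 1 :+ k) :* con 4)
                        := con 4 :* ((con 1 :+ m) :* (con 1 :+ m) :* (con 1 :+ k))) refl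
  N≡ : ∀ m k → (m + 1) ^ 2 * (k + 1) ≡ suc m * suc m * suc k
  N≡ = solve 2 (λ m k → (m :+ con 1) :^ 2 :* (k :+ con 1)
                     := (con 1 :+ m) :* (con 1 :+ m) :* (con 1 :+ k)) refl

corollary2p2 : Σ ℕ λ C → ∀ (n : ℕ) (G : Graph n) →
    Σ (SPS (Var n)) λ F →
      (∀ (x : Var n → ℚ) → evalSPS x F ≡ P G x) ×
      sizeSPS F ≤ C * ((e G + 1) ^ 2 * (n + 1))
corollary2p2 = 5 , λ n G →
  formulaP G ,
  evalSPS-formulaP G ,
  ℕₚ.≤-trans (ℕₚ.≤-reflexive (sizeSPS-formulaP G))
             (1+[1+m]²[4+4k]≤5[m+1]²[k+1] (e G) n)
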